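{- Let $N \equiv 14 \pmod{16}$. Let $EOOE$, $EEOE$, $OEEE$, $OEEO$ denote the numbers of partitions of $N$ into exactly two part sizes lying in the respective parity classes. Then $$EOOE + EEOE + OEEE + OEEO \equiv 0 \pmod 2.$$
   Context: A partition with exactly two part sizes is written $(\lambda_1^{m_1}\lambda_2^{m_2})$ with $\lambda_1>\lambda_2\ge1$ the part sizes and $m_1,m_2\ge1$ their multiplicities. Its parity class is the word $ABCD$ over $\{O,E\}$ where $A,B,C,D$ record whether $\lambda_1, m_1, \lambda_2, m_2$ respectively are odd ($O$) or even ($E$). -}

module Defs where

open import Data.Nat using (ℕ; zero; suc; _+_; _*_; _<_; _≤_; _≟_; _<?_; _≤?_)
open import Data.Nat.Properties using ()
open import Data.Bool using (Bool; true; false; _∧_; if_then_else_)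
open import Data.List using (List; []; _∷_; upTo; concatMap; filter; length)
open import Data.Product using (_×_; _,_)
open import Relation.Nullary.Decidable using (⌊_⌋)

-- A partition with exactly two part sizes (λ₁^m₁ λ₂^m₂), recorded as the
-- quadruple (λ₁ , m₁ , λ₂ , m₂).
TwoSize : Set
TwoSize = ℕ × ℕ × ℕ × ℕ

isTwoSizePartition : ℕ → TwoSize → Bool
isTwoSizePartition N (l1 , m1 , l2 , m2) =
  ⌊ l2 <? l1 ⌋ ∧ ⌊ 1 ≤? l2 ⌋ ∧ ⌊ 1 ≤? m1 ⌋ ∧ ⌊ 1 ≤? m2 ⌋
    ∧ ⌊ l1 * m1 + l2 * m2 ≟ N ⌋

-- All quadruples with entries in {0, …, N}; every two-size partition of N
-- has all four entries ≤ N, so this list contains each exactly once.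
quadruples : ℕ → List TwoSize
quadruples N =
  concatMap (λ a → concatMap (λ b → concatMap (λ c → concatMap (λ d →
    (a , b , c , d) ∷ []) (upTo (suc N))) (upTo (suc N))) (upTo (suc N)))
    (upTo (suc N))

twoSizePartitions : ℕ → List TwoSize
twoSizePartitions N = filter (λ q → isTwoSizePartition N q Data.Bool.≟ true) (quadruples N)
  where import Data.Bool

data Par : Set where
  O E : Par

parity : ℕ → Par
parity zero = E
parity (suc zero) = O
parity (suc (suc n)) = parity n

samePar : Par → Par → Bool
samePar O O = true
samePar E E = true
samePar _ _ = false

inClass : Par → Par → Par → Par → TwoSize → Bool
inClass A B C D (l1 , m1 , l2 , m2) =
  samePar (parity l1) A ∧ samePar (parity m1) B ∧ samePar (parity l2) C ∧ samePar (parity m2) D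

count : Par → Par → Par → Par → ℕ → ℕ
count A B C D N = length (filter (λ q → inClass A B C D q Data.Bool.≟ true) (twoSizePartitions N))
  where import Data.Bool

{-# OPTIONS --safe #-}
module Submission where

-- Write a two-size partition as a pair of blocks ℓ^m.  Transposing the block
-- with odd part (ℓ^m ↦ m^ℓ) turns the partitions of classes EOOE, EEOE, OEEE and
-- OEEO into the ordered pairs (x , z) of blocks of total weight N where x has
-- even part and z has even part and odd multiplicity; which of the two families
-- a pair comes from is read off by comparing the part of x with the
-- multiplicity of z, which differ in parity.  These pairs are the even-part
-- pairs minus those in which z also has even multiplicity, so it suffices that
-- both of those counts are even.  Swapping x and z is an involution on the
-- even-part pairs whose fixed points would need 4 ∣ N.  Transposing z is an
-- involution on the others, with fixed points z = c^c for even c; for such c,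
-- (2a)^b ↦ (2b)^a pairs off the blocks x of weight N − c², and its fixed points
-- would give N = 2a² + c², which is impossible modulo 16.

open import Defs
open import Data.Nat using (ℕ; zero; suc; _+_; _*_; _%_; _≤_; _≟_; _<?_; _≤?_; z≤n; s≤s; >-nonZero)
open import Data.Nat.Properties
open import Algebra.Properties.CommutativeSemigroup +-commutativeSemigroup using () renaming (interchange to +-interchange)
open import Data.Nat.DivMod using (%-distribˡ-+; %-distribˡ-*; m%n%n≡m%n; m%n<n)
open import Data.Nat.Divisibility
  using (_∣_; _∣?_; divides; _∣0; m∣m*n; ∣n⇒∣m*n; ∣m∣n⇒∣m+n; ∣m+n∣m⇒∣n; %-presˡ-∣; n∣m⇒m%n≡0)
open import Data.Nat.Solver using (module +-*-Solver)
open import Data.Bool using (Bool; true; false; _∧_; T) renaming (_≟_ to _≟ᵇ_)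
open import Data.Bool.Properties using (T-∧; ∧-comm)
open import Data.Bool.Solver using (module ∨-∧-Solver)
open import Data.Fin using (Fin; toℕ; fromℕ<)
open import Data.Fin.Properties using (all?; toℕ-fromℕ<)
open import Data.List using (List; []; _∷_; _++_; map; concatMap; filter; length; upTo; cartesianProduct)
open import Data.List.Properties using (map-upTo)
open import Data.Product using (_×_; _,_; proj₁; proj₂; swap; ∃-syntax)
open import Data.Unit using (tt)
open import Function using (_∘_)
open import Function.Bundles using (Equivalence)
open import Relation.Binary.PropositionalEquality
open import Relation.Nullary using (¬_; yes; no; contradiction)
open import Relation.Nullary.Decidable using (⌊_⌋; toWitness; toWitnessFalse; ¬?)

private
  variable
    A B : Set

⟦_⟧ : Bool → ℕ
⟦ true ⟧ = 1
⟦ false ⟧ = 0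

T-∧⁻ : ∀ x {y} → T (x ∧ y) → T x × T y
T-∧⁻ x = Equivalence.to (T-∧ {x})

⟦∧≟⟧≡0 : ∀ p {m n} → (T p → m ≢ n) → ⟦ p ∧ ⌊ m ≟ n ⌋ ⟧ ≡ 0
⟦∧≟⟧≡0 false       _   = refl
⟦∧≟⟧≡0 true {m} {n} m≢n with m ≟ n
... | yes m≡n = contradiction m≡n (m≢n tt)
... | no  _   = refl

⟦∧⟧-factorˡ : ∀ p q e → ⟦ (p ∧ q) ∧ e ⟧ ≡ ⟦ q ⟧ * ⟦ p ∧ e ⟧
⟦∧⟧-factorˡ false false e = refl
⟦∧⟧-factorˡ false true  e = refl
⟦∧⟧-factorˡ true  false e = refl
⟦∧⟧-factorˡ true  true  e = sym (+-identityʳ ⟦ e ⟧)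

⟦<⟧+⟦>⟧ : ∀ m n h → (m ≡ n → h ≡ 0) → ⟦ ⌊ n <? m ⌋ ⟧ * h + ⟦ ⌊ m <? n ⌋ ⟧ * h ≡ h
⟦<⟧+⟦>⟧ m n h m≡n⇒h≡0 with n <? m | m <? n
... | yes n<m | yes m<n = contradiction m<n (<-asym n<m)
... | yes _   | no _    = trans (+-identityʳ (h + 0)) (+-identityʳ h)
... | no _    | yes _   = +-identityʳ h
... | no n≮m  | no m≮n  = sym (m≡n⇒h≡0 (≤-antisym (≮⇒≥ n≮m) (≮⇒≥ m≮n)))

∑ : List A → (A → ℕ) → ℕ
∑ []       f = 0
∑ (x ∷ xs) f = f x + ∑ xs f

infix 10 ∑
syntax ∑ xs (λ x → e) = ∑[ x ∈ xs ] e

∑-cong : ∀ (xs : List A) {f g : A → ℕ} → (∀ x → f x ≡ g x) → ∑ xs f ≡ ∑ xs g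
∑-cong []       f≗g = refl
∑-cong (x ∷ xs) f≗g = cong₂ _+_ (f≗g x) (∑-cong xs f≗g)

∑-zero : ∀ (xs : List A) {f : A → ℕ} → (∀ x → f x ≡ 0) → ∑ xs f ≡ 0
∑-zero []       f≗0 = refl
∑-zero (x ∷ xs) f≗0 = cong₂ _+_ (f≗0 x) (∑-zero xs f≗0)

∑-distrib-+ : ∀ (xs : List A) (f g : A → ℕ) → ∑[ x ∈ xs ] (f x + g x) ≡ ∑ xs f + ∑ xs g
∑-distrib-+ []       f g = refl
∑-distrib-+ (x ∷ xs) f g =
  trans (cong ((f x + g x) +_) (∑-distrib-+ xs f g)) (+-interchange (f x) (g x) (∑ xs f) (∑ xs g))

∑∑-distrib-+ : ∀ (xs : List A) (ys : List B) (f g : A → B → ℕ) →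
               ∑[ x ∈ xs ] ∑[ y ∈ ys ] (f x y + g x y) ≡ ∑[ x ∈ xs ] ∑[ y ∈ ys ] f x y + ∑[ x ∈ xs ] ∑[ y ∈ ys ] g x y
∑∑-distrib-+ xs ys f g = trans (∑-cong xs (λ x → ∑-distrib-+ ys (f x) (g x))) (∑-distrib-+ xs _ _)

∑-*ˡ : ∀ (xs : List A) c (f : A → ℕ) → ∑[ x ∈ xs ] (c * f x) ≡ c * ∑ xs f
∑-*ˡ []       c f = sym (*-zeroʳ c)
∑-*ˡ (x ∷ xs) c f = trans (cong (c * f x +_) (∑-*ˡ xs c f)) (sym (*-distribˡ-+ c (f x) _))

∣-∑ : ∀ {d} (xs : List A) {f : A → ℕ} → (∀ x → d ∣ f x) → d ∣ ∑ xs f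
∣-∑ {d = d} []       d∣f = d ∣0
∣-∑         (x ∷ xs) d∣f = ∣m∣n⇒∣m+n (d∣f x) (∣-∑ xs d∣f)

∑-++ : ∀ (xs ys : List A) (f : A → ℕ) → ∑ (xs ++ ys) f ≡ ∑ xs f + ∑ ys f
∑-++ []       ys f = refl
∑-++ (x ∷ xs) ys f = trans (cong (f x +_) (∑-++ xs ys f)) (sym (+-assoc (f x) _ _))

∑-map : ∀ (g : A → B) (xs : List A) (f : B → ℕ) → ∑ (map g xs) f ≡ ∑[ x ∈ xs ] f (g x)
∑-map g []       f = refl
∑-map g (x ∷ xs) f = cong (f (g x) +_) (∑-map g xs f)

∑-concatMap : ∀ (g : A → List B) (xs : List A) (f : B → ℕ) →
              ∑ (concatMap g xs) f ≡ ∑[ x ∈ xs ] ∑ (g x) f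
∑-concatMap g []       f = refl
∑-concatMap g (x ∷ xs) f = trans (∑-++ (g x) _ f) (cong (∑ (g x) f +_) (∑-concatMap g xs f))

∑-cartesianProduct : ∀ (xs : List A) (ys : List B) (f : A × B → ℕ) →
                     ∑ (cartesianProduct xs ys) f ≡ ∑[ x ∈ xs ] ∑[ y ∈ ys ] f (x , y)
∑-cartesianProduct []       ys f = refl
∑-cartesianProduct (x ∷ xs) ys f = begin
  ∑ (map (x ,_) ys ++ cartesianProduct xs ys) f          ≡⟨ ∑-++ (map (x ,_) ys) _ f ⟩
  ∑ (map (x ,_) ys) f + ∑ (cartesianProduct xs ys) f     ≡⟨ cong₂ _+_ (∑-map (x ,_) ys f) (∑-cartesianProduct xs ys f) ⟩
  ∑[ y ∈ ys ] f (x , y) + ∑[ x′ ∈ xs ] ∑[ y ∈ ys ] f (x′ , y) ∎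
  where open ≡-Reasoning

∑-comm : ∀ (xs : List A) (ys : List B) (f : A → B → ℕ) →
         ∑[ x ∈ xs ] ∑[ y ∈ ys ] f x y ≡ ∑[ y ∈ ys ] ∑[ x ∈ xs ] f x y
∑-comm []       ys f = sym (∑-zero ys (λ _ → refl))
∑-comm (x ∷ xs) ys f = begin
  ∑ ys (f x) + ∑[ x′ ∈ xs ] ∑ ys (f x′)             ≡⟨ cong (∑ ys (f x) +_) (∑-comm xs ys f) ⟩
  ∑ ys (f x) + ∑[ y ∈ ys ] ∑[ x′ ∈ xs ] f x′ y        ≡⟨ sym (∑-distrib-+ ys (f x) _) ⟩
  ∑[ y ∈ ys ] (f x y + ∑[ x′ ∈ xs ] f x′ y)          ∎
  where open ≡-Reasoning

∑-swap : ∀ (xs : List A) (ys : List B) (f : B × A → ℕ) →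
         ∑[ p ∈ cartesianProduct xs ys ] f (swap p) ≡ ∑ (cartesianProduct ys xs) f
∑-swap xs ys f = begin
  ∑[ p ∈ cartesianProduct xs ys ] f (swap p)  ≡⟨ ∑-cartesianProduct xs ys (f ∘ swap) ⟩
  ∑[ x ∈ xs ] ∑[ y ∈ ys ] f (y , x)           ≡⟨ ∑-comm xs ys (λ x y → f (y , x)) ⟩
  ∑[ y ∈ ys ] ∑[ x ∈ xs ] f (y , x)           ≡⟨ sym (∑-cartesianProduct ys xs f) ⟩
  ∑ (cartesianProduct ys xs) f                ∎
  where open ≡-Reasoning

length-filter-filter : ∀ (p q : A → Bool) (xs : List A) →
                       length (filter (λ x → q x ≟ᵇ true) (filter (λ x → p x ≟ᵇ true) xs))
                       ≡ ∑[ x ∈ xs ] ⟦ p x ∧ q x ⟧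
length-filter-filter p q []       = refl
length-filter-filter p q (x ∷ xs) with p x
... | false = length-filter-filter p q xs
... | true with q x
...   | false = length-filter-filter p q xs
...   | true  = cong suc (length-filter-filter p q xs)

∑-upTo-suc : ∀ m (f : ℕ → ℕ) → ∑[ n ∈ upTo (suc m) ] f n ≡ f 0 + ∑[ n ∈ upTo m ] f (suc n)
∑-upTo-suc m f = cong (f 0 +_) (trans (cong (λ ns → ∑ ns f) (sym (map-upTo suc m))) (∑-map suc (upTo m) f))

∑-upTo-+ : ∀ m k (f : ℕ → ℕ) → (∀ n → m ≤ n → f n ≡ 0) → ∑[ n ∈ upTo (m + k) ] f n ≡ ∑[ n ∈ upTo m ] f n
∑-upTo-+ zero    k f f≡0 = ∑-zero (upTo k) (λ n → f≡0 n z≤n)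
∑-upTo-+ (suc m) k f f≡0 = begin
  ∑[ n ∈ upTo (suc (m + k)) ] f n        ≡⟨ ∑-upTo-suc (m + k) f ⟩
  f 0 + ∑[ n ∈ upTo (m + k) ] f (suc n)  ≡⟨ cong (f 0 +_) (∑-upTo-+ m k (f ∘ suc) (λ n m≤n → f≡0 (suc n) (s≤s m≤n))) ⟩
  f 0 + ∑[ n ∈ upTo m ] f (suc n)        ≡⟨ sym (∑-upTo-suc m f) ⟩
  ∑[ n ∈ upTo (suc m) ] f n              ∎
  where open ≡-Reasoning

∑-upTo-double : ∀ m (f : ℕ → ℕ) → (∀ k → f (suc (k + k)) ≡ 0) →
                ∑[ n ∈ upTo (m + m) ] f n ≡ ∑[ n ∈ upTo m ] f (n + n)
∑-upTo-double zero    f f-odd≡0 = refl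
∑-upTo-double (suc m) f f-odd≡0 = begin
  ∑[ n ∈ upTo (suc (m + suc m)) ] f n
    ≡⟨ cong (λ k → ∑[ n ∈ upTo (suc k) ] f n) (+-suc m m) ⟩
  ∑[ n ∈ upTo (suc (suc (m + m))) ] f n
    ≡⟨ ∑-upTo-suc (suc (m + m)) f ⟩
  f 0 + ∑[ n ∈ upTo (suc (m + m)) ] f (suc n)
    ≡⟨ cong (f 0 +_) (∑-upTo-suc (m + m) (f ∘ suc)) ⟩
  f 0 + (f 1 + ∑[ n ∈ upTo (m + m) ] f (suc (suc n)))
    ≡⟨ cong (λ k → f 0 + (k + ∑[ n ∈ upTo (m + m) ] f (suc (suc n)))) (f-odd≡0 0) ⟩
  f 0 + ∑[ n ∈ upTo (m + m) ] f (suc (suc n))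
    ≡⟨ cong (f 0 +_) (∑-upTo-double m (f ∘ suc ∘ suc) (λ k → trans (cong (f ∘ suc) (sym (+-suc (suc k) k))) (f-odd≡0 (suc k)))) ⟩
  f 0 + ∑[ n ∈ upTo m ] f (suc (suc (n + n)))
    ≡⟨ cong (f 0 +_) (∑-cong (upTo m) (λ n → cong (f ∘ suc) (sym (+-suc n n)))) ⟩
  f 0 + ∑[ n ∈ upTo m ] f (suc n + suc n)
    ≡⟨ sym (∑-upTo-suc m (λ n → f (n + n))) ⟩
  ∑[ n ∈ upTo (suc m) ] f (n + n)
    ∎
  where open ≡-Reasoning

∑-upTo-evens : ∀ m (f : ℕ → ℕ) → (∀ k → f (suc (k + k)) ≡ 0) → (∀ n → m ≤ n → f n ≡ 0) →
               ∑[ n ∈ upTo m ] f n ≡ ∑[ n ∈ upTo m ] f (n + n)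
∑-upTo-evens m f f-odd≡0 f-large≡0 = trans (sym (∑-upTo-+ m m f f-large≡0)) (∑-upTo-double m f f-odd≡0)

∑< : List A → (A → A → ℕ) → ℕ
∑< []       h = 0
∑< (x ∷ xs) h = ∑ xs (h x) + ∑< xs h

∑∑-symmetric : ∀ (xs : List A) (h : A → A → ℕ) → (∀ x y → h x y ≡ h y x) →
               ∑[ x ∈ xs ] ∑[ y ∈ xs ] h x y ≡ ∑[ x ∈ xs ] h x x + 2 * ∑< xs h
∑∑-symmetric []       h h-sym = refl
∑∑-symmetric (z ∷ zs) h h-sym = begin
  (h z z + S) + ∑[ x ∈ zs ] (h x z + ∑ zs (h x))   ≡⟨ cong ((h z z + S) +_) (∑-distrib-+ zs (λ x → h x z) _) ⟩
  (h z z + S) + (∑[ x ∈ zs ] h x z + Q)            ≡⟨ cong (λ n → (h z z + S) + (n + Q)) (∑-cong zs (λ x → h-sym x z)) ⟩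
  (h z z + S) + (S + Q)                            ≡⟨ cong (λ n → (h z z + S) + (S + n)) (∑∑-symmetric zs h h-sym) ⟩
  (h z z + S) + (S + (D + 2 * U))                  ≡⟨ solve 4 (λ a s d u → (a :+ s) :+ (s :+ (d :+ con 2 :* u))
                                                                 := (a :+ d) :+ con 2 :* (s :+ u)) refl (h z z) S D U ⟩
  (h z z + D) + 2 * (S + U)                        ∎
  where
  open ≡-Reasoning
  open +-*-Solver using (solve; _:+_; _:*_; _:=_; con)
  S Q D U : ℕ
  S = ∑ zs (h z)
  Q = ∑[ x ∈ zs ] ∑[ y ∈ zs ] h x y
  D = ∑[ x ∈ zs ] h x x
  U = ∑< zs h

∑∑-symmetric-even : ∀ (xs : List A) (h : A → A → ℕ) → (∀ x y → h x y ≡ h y x) →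
                    2 ∣ ∑[ x ∈ xs ] h x x → 2 ∣ ∑[ x ∈ xs ] ∑[ y ∈ xs ] h x y
∑∑-symmetric-even xs h h-sym 2∣diagonal =
  subst (2 ∣_) (sym (∑∑-symmetric xs h h-sym)) (∣m∣n⇒∣m+n 2∣diagonal (m∣m*n (∑< xs h)))

∑∑-split-by-order : ∀ (xs : List A) (key : A → ℕ) (h : A → A → ℕ) →
                    (∀ x y → key x ≡ key y → h x y ≡ 0) →
                    ∑[ x ∈ xs ] ∑[ y ∈ xs ] (⟦ ⌊ key y <? key x ⌋ ⟧ * h x y)
                      + ∑[ x ∈ xs ] ∑[ y ∈ xs ] (⟦ ⌊ key y <? key x ⌋ ⟧ * h y x)
                    ≡ ∑[ x ∈ xs ] ∑[ y ∈ xs ] h x y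
∑∑-split-by-order {A = A} xs key h h-diagonal = begin
  ∑[ x ∈ xs ] ∑[ y ∈ xs ] (below x y * h x y) + ∑[ x ∈ xs ] ∑[ y ∈ xs ] (below x y * h y x)
    ≡⟨ cong (∑[ x ∈ xs ] ∑[ y ∈ xs ] (below x y * h x y) +_) (∑-comm xs xs (λ x y → below x y * h y x)) ⟩
  ∑[ x ∈ xs ] ∑[ y ∈ xs ] (below x y * h x y) + ∑[ x ∈ xs ] ∑[ y ∈ xs ] (below y x * h x y)
    ≡⟨ sym (∑-distrib-+ xs _ _) ⟩
  ∑[ x ∈ xs ] (∑[ y ∈ xs ] (below x y * h x y) + ∑[ y ∈ xs ] (below y x * h x y))
    ≡⟨ ∑-cong xs (λ x → sym (∑-distrib-+ xs _ _)) ⟩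
  ∑[ x ∈ xs ] ∑[ y ∈ xs ] (below x y * h x y + below y x * h x y)
    ≡⟨ ∑-cong xs (λ x → ∑-cong xs (λ y → ⟦<⟧+⟦>⟧ (key x) (key y) (h x y) (h-diagonal x y))) ⟩
  ∑[ x ∈ xs ] ∑[ y ∈ xs ] h x y
    ∎
  where
  open ≡-Reasoning
  below : A → A → ℕ
  below x y = ⟦ ⌊ key y <? key x ⌋ ⟧

-- Two-size partitions as pairs of blocks

-- (ℓ , m) is the block ℓ^m: the part ℓ repeated m times.
Block : Set
Block = ℕ × ℕ

blocks : ℕ → List Block
blocks N = cartesianProduct (upTo (suc N)) (upTo (suc N))

_⊗_ : Block → Block → TwoSize
(ℓ₁ , m₁) ⊗ (ℓ₂ , m₂) = ℓ₁ , m₁ , ℓ₂ , m₂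

∑-quadruples : ∀ N (f : TwoSize → ℕ) → ∑ (quadruples N) f ≡ ∑[ x ∈ blocks N ] ∑[ y ∈ blocks N ] f (x ⊗ y)
∑-quadruples N f = begin
  ∑ (quadruples N) f
    ≡⟨ ∑-concatMap (λ a → concatMap (λ b → concatMap (λ c → concatMap (λ d → (a , b , c , d) ∷ []) R) R) R) R f ⟩
  ∑[ a ∈ R ] ∑ (concatMap (λ b → concatMap (λ c → concatMap (λ d → (a , b , c , d) ∷ []) R) R) R) f
    ≡⟨ ∑-cong R (λ a → trans (∑-concatMap (λ b → concatMap (λ c → concatMap (λ d → (a , b , c , d) ∷ []) R) R) R f)
         (∑-cong R (λ b → trans (∑-concatMap (λ c → concatMap (λ d → (a , b , c , d) ∷ []) R) R f)
         (∑-cong R (λ c → trans (∑-concatMap (λ d → (a , b , c , d) ∷ []) R f)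
         (∑-cong R (λ d → +-identityʳ _))))))) ⟩
  ∑[ a ∈ R ] ∑[ b ∈ R ] ∑[ c ∈ R ] ∑[ d ∈ R ] f (a , b , c , d)
    ≡⟨ sym (∑-cong R (λ a → ∑-cong R (λ b → ∑-cartesianProduct R R (λ y → f ((a , b) ⊗ y))))) ⟩
  ∑[ a ∈ R ] ∑[ b ∈ R ] ∑[ y ∈ blocks N ] f ((a , b) ⊗ y)
    ≡⟨ sym (∑-cartesianProduct R R (λ x → ∑[ y ∈ blocks N ] f (x ⊗ y))) ⟩
  ∑[ x ∈ blocks N ] ∑[ y ∈ blocks N ] f (x ⊗ y)
    ∎
  where
  open ≡-Reasoning
  R : List ℕ
  R = upTo (suc N)

classIndicator : Par → Par → Par → Par → ℕ → TwoSize → ℕ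
classIndicator A B C D N q = ⟦ isTwoSizePartition N q ∧ inClass A B C D q ⟧

count≡∑∑ : ∀ A B C D N → count A B C D N ≡ ∑[ x ∈ blocks N ] ∑[ y ∈ blocks N ] classIndicator A B C D N (x ⊗ y)
count≡∑∑ A B C D N = trans (length-filter-filter (isTwoSizePartition N) (inClass A B C D) (quadruples N))
                           (∑-quadruples N (classIndicator A B C D N))

pos : ℕ → Bool
pos n = ⌊ 1 ≤? n ⌋

even odd posEven posOdd : ℕ → Bool
even n    = samePar (parity n) E
odd n     = samePar (parity n) O
posEven n = pos n ∧ even n
posOdd n  = pos n ∧ odd n

even-double : ∀ k → even (k + k) ≡ true
even-double zero    = refl
even-double (suc k) = trans (cong (even ∘ suc) (+-suc k k)) (even-double k)

even-suc-double : ∀ k → even (suc (k + k)) ≡ false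
even-suc-double zero    = refl
even-suc-double (suc k) = trans (cong (even ∘ suc ∘ suc) (+-suc k k)) (even-suc-double k)

posEven-double : ∀ k → posEven (k + k) ≡ pos k
posEven-double zero    = refl
posEven-double (suc k) = even-double (suc k)

even⇒double : ∀ n → T (even n) → ∃[ k ] n ≡ k + k
even⇒double zero          _ = 0 , refl
even⇒double (suc (suc n)) t with even⇒double n t
... | k , refl = suc k , cong suc (sym (+-suc k k))

even⇒¬odd : ∀ n → T (even n) → ¬ T (odd n)
even⇒¬odd n with parity n
... | E = λ _ ()
... | O = λ ()

weight : Block → ℕ
weight (ℓ , m) = ℓ * m

evenBlock evenOddBlock evenEvenBlock : Block → Bool
evenBlock     (ℓ , m) = posEven ℓ ∧ pos m
evenOddBlock  (ℓ , m) = posEven ℓ ∧ posOdd m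
evenEvenBlock (ℓ , m) = posEven ℓ ∧ posEven m

evenBlock⇒even : ∀ ℓ m → T (evenBlock (ℓ , m)) → T (even ℓ)
evenBlock⇒even ℓ m t = proj₂ (T-∧⁻ (pos ℓ) (proj₁ (T-∧⁻ (posEven ℓ) t)))

weightPair : ℕ → (Block → Bool) → (Block → Bool) → Block → Block → ℕ
weightPair N P Q x z = ⟦ (P x ∧ Q z) ∧ ⌊ weight x + weight z ≟ N ⌋ ⟧

pairCount : ℕ → (Block → Bool) → (Block → Bool) → ℕ
pairCount N P Q = ∑[ x ∈ blocks N ] ∑[ z ∈ blocks N ] weightPair N P Q x z

weightPair-split : ∀ N P x z →
                   weightPair N P evenOddBlock x z + weightPair N P evenEvenBlock x z ≡ weightPair N P evenBlock x z
weightPair-split N P x (ℓ , m) with P x | posEven ℓ | pos m | parity m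
... | false | _     | _     | _ = refl
... | true  | false | _     | _ = refl
... | true  | true  | false | _ = refl
... | true  | true  | true  | O = +-identityʳ _
... | true  | true  | true  | E = refl

pairCount-split : ∀ N P → pairCount N P evenOddBlock + pairCount N P evenEvenBlock ≡ pairCount N P evenBlock
pairCount-split N P = trans (sym (∑∑-distrib-+ (blocks N) (blocks N) (weightPair N P evenOddBlock) (weightPair N P evenEvenBlock)))
                            (∑-cong (blocks N) (λ x → ∑-cong (blocks N) (weightPair-split N P x)))

weightPair-sym : ∀ N P x z → weightPair N P P x z ≡ weightPair N P P z x
weightPair-sym N P x z = cong₂ (λ b n → ⟦ b ∧ ⌊ n ≟ N ⌋ ⟧) (∧-comm (P x) (P z)) (+-comm (weight x) (weight z))

inClass-E?OE : ∀ t a b c d → ⟦ t ∧ inClass E O O E (a , b , c , d) ⟧ + ⟦ t ∧ inClass E E O E (a , b , c , d) ⟧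
                             ≡ ⟦ t ∧ (even a ∧ odd c ∧ even d) ⟧
inClass-E?OE false a b c d = refl
inClass-E?OE true  a b c d with parity a | parity b
... | O | _ = refl
... | E | O = +-identityʳ _
... | E | E = refl

inClass-OEE? : ∀ t a b c d → ⟦ t ∧ inClass O E E E (a , b , c , d) ⟧ + ⟦ t ∧ inClass O E E O (a , b , c , d) ⟧
                             ≡ ⟦ t ∧ (odd a ∧ even b ∧ even c) ⟧
inClass-OEE? false a b c d = refl
inClass-OEE? true  a b c d with parity a | parity b | parity c | parity d
... | E | _ | _ | _ = refl
... | O | O | _ | _ = refl
... | O | E | O | _ = refl
... | O | E | E | E = refl
... | O | E | E | O = refl

evenOddPairᵀ : ℕ → Block → Block → ℕ
evenOddPairᵀ N x y = weightPair N evenBlock evenOddBlock x (swap y)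

-- Since c < a forces a to be a successor, pos a reduces to true and what is
-- left only reorders conjunctions.
E?OE-as-pair : ∀ N a b c d → ⟦ isTwoSizePartition N (a , b , c , d) ∧ (even a ∧ odd c ∧ even d) ⟧
                          ≡ ⟦ ⌊ c <? a ⌋ ⟧ * evenOddPairᵀ N (a , b) (c , d)
E?OE-as-pair N a b c d with c <? a
... | no _          = refl
... | yes (s≤s _) rewrite *-comm d c = trans
  (cong ⟦_⟧ (solve 7 (λ pb pc pd e ea oc ed → (pc :* (pb :* (pd :* e))) :* (ea :* (oc :* ed))
                                            := ((ea :* pb) :* ((pd :* ed) :* (pc :* oc))) :* e)
                     refl (pos b) (pos c) (pos d) _ (even a) (odd c) (even d)))
  (sym (+-identityʳ _))
  where open ∨-∧-Solver using (solve; _:*_; _:=_)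

OEE?-as-pair : ∀ N a b c d → ⟦ isTwoSizePartition N (a , b , c , d) ∧ (odd a ∧ even b ∧ even c) ⟧
                          ≡ ⟦ ⌊ c <? a ⌋ ⟧ * evenOddPairᵀ N (c , d) (a , b)
OEE?-as-pair N a b c d with c <? a
... | no _          = refl
... | yes (s≤s _) rewrite +-comm (c * d) (b * a) | *-comm b a = trans
  (cong ⟦_⟧ (solve 7 (λ pb pc pd e oa eb ec → (pc :* (pb :* (pd :* e))) :* (oa :* (eb :* ec))
                                            := (((pc :* ec) :* pd) :* ((pb :* eb) :* oa)) :* e)
                     refl (pos b) (pos c) (pos d) _ (odd a) (even b) (even c)))
  (sym (+-identityʳ _))
  where open ∨-∧-Solver using (solve; _:*_; _:=_)

evenOddPairᵀ-samePart≡0 : ∀ N x y → proj₁ x ≡ proj₁ y → evenOddPairᵀ N x y ≡ 0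
evenOddPairᵀ-samePart≡0 N (a , b) (.a , d) refl = ⟦∧≟⟧≡0 (evenBlock (a , b) ∧ evenOddBlock (d , a)) λ t _ →
  let (x-even , y-oddMult) = T-∧⁻ (evenBlock (a , b)) t in
  even⇒¬odd a (evenBlock⇒even a b x-even) (proj₂ (T-∧⁻ (pos a) (proj₂ (T-∧⁻ (posEven d) y-oddMult))))

classes≡evenOddPairs : ∀ N → count E O O E N + count E E O E N + count O E E E N + count O E E O N
                         ≡ pairCount N evenBlock evenOddBlock
classes≡evenOddPairs N = begin
  count E O O E N + count E E O E N + count O E E E N + count O E E O N
    ≡⟨ cong₂ _+_ (cong₂ _+_ (cong₂ _+_ (count≡∑∑ E O O E N) (count≡∑∑ E E O E N)) (count≡∑∑ O E E E N)) (count≡∑∑ O E E O N) ⟩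
  ∑∑ (F E O O E) + ∑∑ (F E E O E) + ∑∑ (F O E E E) + ∑∑ (F O E E O)
    ≡⟨ +-assoc (∑∑ (F E O O E) + ∑∑ (F E E O E)) (∑∑ (F O E E E)) (∑∑ (F O E E O)) ⟩
  (∑∑ (F E O O E) + ∑∑ (F E E O E)) + (∑∑ (F O E E E) + ∑∑ (F O E E O))
    ≡⟨ sym (cong₂ _+_ (∑∑-distrib-+ (blocks N) (blocks N) (F E O O E) (F E E O E)) (∑∑-distrib-+ (blocks N) (blocks N) (F O E E E) (F O E E O))) ⟩
  ∑∑ (λ x y → F E O O E x y + F E E O E x y) + ∑∑ (λ x y → F O E E E x y + F O E E O x y)
    ≡⟨ cong₂ _+_ (∑-cong (blocks N) (λ x → ∑-cong (blocks N) (λ y → E?OE x y))) (∑-cong (blocks N) (λ x → ∑-cong (blocks N) (λ y → OEE? x y))) ⟩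
  ∑∑ (λ x y → ⟦ ⌊ proj₁ y <? proj₁ x ⌋ ⟧ * evenOddPairᵀ N x y) + ∑∑ (λ x y → ⟦ ⌊ proj₁ y <? proj₁ x ⌋ ⟧ * evenOddPairᵀ N y x)
    ≡⟨ ∑∑-split-by-order (blocks N) proj₁ (evenOddPairᵀ N) (evenOddPairᵀ-samePart≡0 N) ⟩
  ∑∑ (evenOddPairᵀ N)
    ≡⟨ ∑-cong (blocks N) (λ x → ∑-swap (upTo (suc N)) (upTo (suc N)) (weightPair N evenBlock evenOddBlock x)) ⟩
  pairCount N evenBlock evenOddBlock
    ∎
  where
  open ≡-Reasoning
  ∑∑ : (Block → Block → ℕ) → ℕ
  ∑∑ f = ∑[ x ∈ blocks N ] ∑[ y ∈ blocks N ] f x y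
  F : Par → Par → Par → Par → Block → Block → ℕ
  F P₁ P₂ P₃ P₄ x y = classIndicator P₁ P₂ P₃ P₄ N (x ⊗ y)
  E?OE : ∀ x y → F E O O E x y + F E E O E x y ≡ ⟦ ⌊ proj₁ y <? proj₁ x ⌋ ⟧ * evenOddPairᵀ N x y
  E?OE (a , b) (c , d) = trans (inClass-E?OE (isTwoSizePartition N (a , b , c , d)) a b c d) (E?OE-as-pair N a b c d)
  OEE? : ∀ x y → F O E E E x y + F O E E O x y ≡ ⟦ ⌊ proj₁ y <? proj₁ x ⌋ ⟧ * evenOddPairᵀ N y x
  OEE? (a , b) (c , d) = trans (inClass-OEE? (isTwoSizePartition N (a , b , c , d)) a b c d) (OEE?-as-pair N a b c d)

-- Pairs of blocks with even parts

evenBlock⇒4∣weight+weight : ∀ x → T (evenBlock x) → 4 ∣ weight x + weight x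
evenBlock⇒4∣weight+weight (ℓ , m) t with even⇒double ℓ (evenBlock⇒even ℓ m t)
... | k , refl = divides (k * m) (solve 2 (λ k m → (k :+ k) :* m :+ (k :+ k) :* m := (k :* m) :* con 4) refl k m)
  where open +-*-Solver using (solve; _:+_; _:*_; _:=_; con)

evenPairs-even : ∀ N → ¬ 4 ∣ N → 2 ∣ pairCount N evenBlock evenBlock
evenPairs-even N 4∤N = ∑∑-symmetric-even (blocks N) (weightPair N evenBlock evenBlock) (weightPair-sym N evenBlock)
  (subst (2 ∣_) (sym (∑-zero (blocks N) diagonal≡0)) (2 ∣0))
  where
  diagonal≡0 : ∀ x → weightPair N evenBlock evenBlock x x ≡ 0
  diagonal≡0 x = ⟦∧≟⟧≡0 (evenBlock x ∧ evenBlock x)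
    (λ t 2wx≡N → 4∤N (subst (4 ∣_) 2wx≡N (evenBlock⇒4∣weight+weight x (proj₁ (T-∧⁻ (evenBlock x) t)))))

evenPartBlocks : ℕ → ℕ → ℕ
evenPartBlocks N w = ∑[ x ∈ blocks N ] ⟦ evenBlock x ∧ ⌊ weight x + w ≟ N ⌋ ⟧

-- Halving the even part turns the sum over blocks (2a)^b into one symmetric in
-- (a , b).
evenPartBlocks-even : ∀ N r → (∀ y → (y + y) * y + r ≢ N) → 2 ∣ evenPartBlocks N r
evenPartBlocks-even N r no-diagonal = subst (2 ∣_) (sym halved)
  (∑∑-symmetric-even R h h-sym (subst (2 ∣_) (sym (∑-zero R h-diagonal≡0)) (2 ∣0)))
  where
  open ≡-Reasoning
  R : List ℕ
  R = upTo (suc N)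
  g h : ℕ → ℕ → ℕ
  g a b = ⟦ evenBlock (a , b) ∧ ⌊ a * b + r ≟ N ⌋ ⟧
  h a b = ⟦ (pos a ∧ pos b) ∧ ⌊ (a + a) * b + r ≟ N ⌋ ⟧

  g-odd≡0 : ∀ k → ∑[ b ∈ R ] g (suc (k + k)) b ≡ 0
  g-odd≡0 k = ∑-zero R (λ b → cong (λ e → ⟦ (e ∧ pos b) ∧ ⌊ suc (k + k) * b + r ≟ N ⌋ ⟧) (even-suc-double k))

  g-large≡0 : ∀ a → suc N ≤ a → ∑[ b ∈ R ] g a b ≡ 0
  g-large≡0 a N<a = ∑-zero R (λ b → ⟦∧≟⟧≡0 (evenBlock (a , b)) (λ t ab+r≡N →
    let 1≤b = toWitness (proj₂ (T-∧⁻ (posEven a) t)) in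
    <-irrefl refl (<-≤-trans N<a (≤-trans (m≤m*n a b {{>-nonZero 1≤b}}) (subst (a * b ≤_) ab+r≡N (m≤m+n (a * b) r))))))

  halved : evenPartBlocks N r ≡ ∑[ a ∈ R ] ∑[ b ∈ R ] h a b
  halved = begin
    evenPartBlocks N r                 ≡⟨ ∑-cartesianProduct R R _ ⟩
    ∑[ a ∈ R ] ∑[ b ∈ R ] g a b        ≡⟨ ∑-upTo-evens (suc N) (λ a → ∑[ b ∈ R ] g a b) g-odd≡0 g-large≡0 ⟩
    ∑[ a ∈ R ] ∑[ b ∈ R ] g (a + a) b  ≡⟨ ∑-cong R (λ a → ∑-cong R (λ b →
                                            cong (λ p → ⟦ (p ∧ pos b) ∧ ⌊ (a + a) * b + r ≟ N ⌋ ⟧) (posEven-double a))) ⟩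
    ∑[ a ∈ R ] ∑[ b ∈ R ] h a b        ∎

  h-sym : ∀ a b → h a b ≡ h b a
  h-sym a b = cong₂ (λ p n → ⟦ p ∧ ⌊ n + r ≟ N ⌋ ⟧) (∧-comm (pos a) (pos b))
    (solve 2 (λ a b → (a :+ a) :* b := (b :+ b) :* a) refl a b)
    where open +-*-Solver using (solve; _:+_; _:*_; _:=_)

  h-diagonal≡0 : ∀ a → h a a ≡ 0
  h-diagonal≡0 a = ⟦∧≟⟧≡0 (pos a ∧ pos a) (λ _ → no-diagonal a)

evenEvenPairs-even : ∀ N → (∀ y k → (y + y) * y + (k + k) * (k + k) ≢ N) → 2 ∣ pairCount N evenBlock evenEvenBlock
evenEvenPairs-even N N≢2y²+4k² = subst (2 ∣_) (sym by-second-block)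
  (∑∑-symmetric-even R φ φ-sym (∣-∑ R φ-diagonal-even))
  where
  open ≡-Reasoning
  R : List ℕ
  R = upTo (suc N)
  φ : ℕ → ℕ → ℕ
  φ ℓ m = ⟦ evenEvenBlock (ℓ , m) ⟧ * evenPartBlocks N (ℓ * m)

  by-second-block : pairCount N evenBlock evenEvenBlock ≡ ∑[ ℓ ∈ R ] ∑[ m ∈ R ] φ ℓ m
  by-second-block = begin
    pairCount N evenBlock evenEvenBlock
      ≡⟨ ∑-comm (blocks N) (blocks N) (weightPair N evenBlock evenEvenBlock) ⟩
    ∑[ z ∈ blocks N ] ∑[ x ∈ blocks N ] weightPair N evenBlock evenEvenBlock x z
      ≡⟨ ∑-cong (blocks N) (λ z → trans (∑-cong (blocks N) (λ x → ⟦∧⟧-factorˡ (evenBlock x) (evenEvenBlock z) _))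
                                        (∑-*ˡ (blocks N) ⟦ evenEvenBlock z ⟧ _)) ⟩
    ∑[ z ∈ blocks N ] (⟦ evenEvenBlock z ⟧ * evenPartBlocks N (weight z))
      ≡⟨ ∑-cartesianProduct R R _ ⟩
    ∑[ ℓ ∈ R ] ∑[ m ∈ R ] φ ℓ m
      ∎

  φ-sym : ∀ ℓ m → φ ℓ m ≡ φ m ℓ
  φ-sym ℓ m = cong₂ (λ b w → ⟦ b ⟧ * evenPartBlocks N w) (∧-comm (posEven ℓ) (posEven m)) (*-comm ℓ m)

  φ-diagonal-even : ∀ c → 2 ∣ ⟦ posEven c ∧ posEven c ⟧ * evenPartBlocks N (c * c)
  φ-diagonal-even c with posEven c in c-posEven
  ... | false = 2 ∣0
  ... | true  with even⇒double c (proj₂ (T-∧⁻ (pos c) (subst T (sym c-posEven) tt)))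
  ...   | k , refl = ∣n⇒∣m*n 1 (evenPartBlocks-even N ((k + k) * (k + k)) (λ y → N≢2y²+4k² y k))

-- Arithmetic modulo 16

N≡14[16]⇒4∤N : ∀ N → N % 16 ≡ 14 → ¬ 4 ∣ N
N≡14[16]⇒4∤N N N%16≡14 4∣N = toWitnessFalse {a? = 4 ∣? 14} tt (subst (4 ∣_) N%16≡14 (%-presˡ-∣ 4∣N (divides 4 refl)))

private
  infix 4 _≡₁₆_
  record _≡₁₆_ (m n : ℕ) : Set where
    constructor mod16
    field %16-≡ : m % 16 ≡ n % 16
  open _≡₁₆_

  +-cong₁₆ : ∀ {a b c d} → a ≡₁₆ b → c ≡₁₆ d → a + c ≡₁₆ b + d
  +-cong₁₆ {a} {b} {c} {d} (mod16 a≡b) (mod16 c≡d) = mod16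
    (trans (%-distribˡ-+ a c 16) (trans (cong₂ (λ u v → (u + v) % 16) a≡b c≡d) (sym (%-distribˡ-+ b d 16))))

  *-cong₁₆ : ∀ {a b c d} → a ≡₁₆ b → c ≡₁₆ d → a * c ≡₁₆ b * d
  *-cong₁₆ {a} {b} {c} {d} (mod16 a≡b) (mod16 c≡d) = mod16
    (trans (%-distribˡ-* a c 16) (trans (cong₂ (λ u v → (u * v) % 16) a≡b c≡d) (sym (%-distribˡ-* b d 16))))

  ≡₁₆-% : ∀ m → m ≡₁₆ m % 16
  ≡₁₆-% m = mod16 (sym (m%n%n≡m%n m 16))

2y²+4k²≢14[16] : ∀ y k → ((y + y) * y + (k + k) * (k + k)) % 16 ≢ 14
2y²+4k²≢14[16] y k f[y,k]≡14 = residues (fromℕ< (m%n<n y 16)) (fromℕ< (m%n<n k 16)) (begin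
  f (toℕ (fromℕ< (m%n<n y 16))) (toℕ (fromℕ< (m%n<n k 16))) % 16
    ≡⟨ cong₂ (λ u v → f u v % 16) (toℕ-fromℕ< (m%n<n y 16)) (toℕ-fromℕ< (m%n<n k 16)) ⟩
  f (y % 16) (k % 16) % 16
    ≡⟨ sym (%16-≡ (f-cong (≡₁₆-% y) (≡₁₆-% k))) ⟩
  f y k % 16
    ≡⟨ f[y,k]≡14 ⟩
  14 ∎)
  where
  open ≡-Reasoning
  f : ℕ → ℕ → ℕ
  f y k = (y + y) * y + (k + k) * (k + k)
  f-cong : ∀ {y y′ k k′} → y ≡₁₆ y′ → k ≡₁₆ k′ → f y k ≡₁₆ f y′ k′
  f-cong y≡y′ k≡k′ = +-cong₁₆ (*-cong₁₆ (+-cong₁₆ y≡y′ y≡y′) y≡y′) (*-cong₁₆ (+-cong₁₆ k≡k′ k≡k′) (+-cong₁₆ k≡k′ k≡k′))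
  -- decided by evaluating all 16 × 16 residue pairs
  residues : ∀ (r s : Fin 16) → f (toℕ r) (toℕ s) % 16 ≢ 14
  residues = toWitness {a? = all? (λ r → all? (λ s → ¬? (f (toℕ r) (toℕ s) % 16 ≟ 14)))} tt

not-2y²+4k² : ∀ N → N % 16 ≡ 14 → ∀ y k → (y + y) * y + (k + k) * (k + k) ≢ N
not-2y²+4k² N N%16≡14 y k eq = 2y²+4k²≢14[16] y k (trans (cong (_% 16) eq) N%16≡14)

corollary3p4 : (N : ℕ) → N % 16 ≡ 14 →
    (count E O O E N + count E E O E N + count O E E E N + count O E E O N) % 2 ≡ 0
corollary3p4 N N%16≡14 = n∣m⇒m%n≡0 _ 2 (subst (2 ∣_) (sym (classes≡evenOddPairs N)) 2∣evenOddPairs)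
  where
  2∣evenPairs : 2 ∣ pairCount N evenBlock evenBlock
  2∣evenPairs = evenPairs-even N (N≡14[16]⇒4∤N N N%16≡14)
  2∣evenEvenPairs : 2 ∣ pairCount N evenBlock evenEvenBlock
  2∣evenEvenPairs = evenEvenPairs-even N (not-2y²+4k² N N%16≡14)
  2∣evenOddPairs : 2 ∣ pairCount N evenBlock evenOddBlock
  2∣evenOddPairs = ∣m+n∣m⇒∣n (subst (2 ∣_) (sym (trans (+-comm (pairCount N evenBlock evenEvenBlock) _) (pairCount-split N evenBlock))) 2∣evenPairs)
                         2∣evenEvenPairs
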